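{- Let $w,n$ be positive integers. For a semistandard Young tableau $R$ of rectangular shape with $w$ columns and $n$ rows whose content consists of $w-1$ copies of each of $1,\ldots,n$ and one copy of each of $n+1,\ldots,2n$, define $Q$ as the tableau obtained from the cells of $R$ containing entries in $\{n+1,\ldots,2n\}$ by rotating them by $180^\circ$ and replacing each entry $x$ by $2n-x+1$, and define $P=\overline{R-Q}^{w,n}$. Then $R\mapsto (P,Q)$ is a bijection from the set of such tableaux $R$ onto the set of pairs of standard Young tableaux of the same shape having $n$ cells and at most $w$ columns.
   Context: Tableaux are semistandard (rows weakly, columns strictly increasing); standard means entries $1,\ldots,n$ each appear once with rows and columns strictly increasing. Columns are indexed from left to right. If $Q$ has shape $\lambda$ with column lengths $\lambda_1\ge\lambda_2\ge\cdots$ (at most $w$ columns), $R-Q$ is the tableau whose $i$-th column consists of the $n-\lambda_{w-i+1}$ smallest entries of the $i$-th column of $R$. For a tableau $A$ with columns $A_1,\ldots,A_w$ (possibly empty) and entries in $[n]$, the tableau complement $\overline{A}^{w,n}$ has $i$-th column equal to $[n]\setminus A_{w-i+1}$ in increasing order, for $1\le i\le w$. -}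

module Defs where

open import Data.Nat using (ℕ; zero; suc; _+_; _*_; _∸_; _≤_; _<_; _<?_; _≤?_; _≟_)
open import Data.Bool using (if_then_else_)
open import Data.Product using (_×_; _,_; uncurry; ∃-syntax)
open import Data.List using (List; []; _∷_; length; map; filter; reverse; take; concat; zip; upTo)
open import Data.List.Relation.Unary.All using (All)
open import Data.List.Relation.Unary.Linked using (Linked)
open import Data.List.Relation.Binary.Permutation.Propositional using (_↭_)
open import Data.List.Membership.DecPropositional _≟_ using (_∈?_)
open import Relation.Nullary using (¬?; does)
open import Relation.Binary.PropositionalEquality using (_≡_)

-- Tableaux. A tableau is the list of its columns, from left to right;
-- each column is listed from top to bottom.

Column : Set
Column = List ℕ

Tableau : Set
Tableau = List Column

-- i-th column (0-indexed), empty if absent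
col : Tableau → ℕ → Column
col []       _       = []
col (c ∷ _)  zero    = c
col (_ ∷ cs) (suc i) = col cs i

oneTo : ℕ → List ℕ
oneTo n = map suc (upTo n)

-- adjacent columns c (left), c' (right): c' is not longer than c and the
-- rows meeting both columns satisfy R c[k] c'[k]
AdjCols : (ℕ → ℕ → Set) → Column → Column → Set
AdjCols R c c' = (length c' ≤ length c) × All (uncurry R) (zip c c')

-- semistandard: columns strictly increasing, rows weakly increasing,
-- column lengths weakly decreasing (the shape is a partition)
IsSSYT : Tableau → Set
IsSSYT T = All (Linked _<_) T × Linked (AdjCols _≤_) T

-- standard tableau with n cells (entries exactly 1..n) and at most w columns,
-- encoded with exactly w columns (trailing columns may be empty)
IsSYT : ℕ → ℕ → Tableau → Set
IsSYT w n T = (length T ≡ w) × (concat T ↭ oneTo n)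
            × All (Linked _<_) T × Linked (AdjCols _<_) T

occ : ℕ → List ℕ → ℕ
occ x l = length (filter (x ≟_) l)

mult : ℕ → ℕ → ℕ → ℕ
mult w n zero    = 0
mult w n (suc x) =
  if does (suc x ≤? n) then w ∸ 1
  else (if does (suc x ≤? n + n) then 1 else 0)

IsR : ℕ → ℕ → Tableau → Set
IsR w n R = IsSSYT R × (length R ≡ w) × All (λ c → length c ≡ n) R
          × (∀ x → occ x (concat R) ≡ mult w n x)

-- Q: take the cells of R with entries in {n+1,…,2n} (the bottom part of each
-- column), rotate by 180° inside the rectangle (column order reversed,
-- each column read bottom to top, so these cells become top-justified),
-- and replace x by 2n - x + 1.
Qof : ℕ → Tableau → Tableau
Qof n R = map (λ c → map (λ x → (n + n + 1) ∸ x) (reverse (filter (n <?_) c)))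
              (reverse R)

-- R - Q: i-th column (1-indexed) = the n - λ_{w-i+1} smallest entries of the
-- i-th column of R, λ_j = length of the j-th column of Q (0 if absent).
-- With 0-indexed i: take (n ∸ λ_{w-1-i}) (col R i), for i = 0..w-1.
minus : ℕ → ℕ → Tableau → Tableau → Tableau
minus w n R Q = map (λ i → take (n ∸ length (col Q (w ∸ 1 ∸ i))) (col R i)) (upTo w)

-- complement: i-th column (1-indexed) = [n] \ A_{w-i+1}, increasing;
-- 0-indexed: [n] \ A_{w-1-i}, for i = 0..w-1.
compl : ℕ → ℕ → Tableau → Tableau
compl w n A = map (λ i → filter (λ x → ¬? (x ∈? col A (w ∸ 1 ∸ i))) (oneTo n)) (upTo w)

Φ : ℕ → ℕ → Tableau → Tableau × Tableau
Φ w n R = compl w n (minus w n R (Qof n R)) , Qof n R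

IsSYTPair : ℕ → ℕ → Tableau × Tableau → Set
IsSYTPair w n (P , Q) = IsSYT w n P × IsSYT w n Q × (map length P ≡ map length Q)

module Submission where

-- Φ works column by column: the i-th columns of P and Q come from the
-- (w+1-i)-th column c of R.  Being increasing of length n with entries in
-- [2n], c = small ++ large with small ⊆ [n] and large ⊆ [n+1, 2n]; Q gets
-- q = 2n+1 - reverse large and P gets p = [n] ∖ small.  Conversely each pair
-- (p , q) of increasing lists in [n] of equal length comes from exactly one
-- column mkColumn n p q = ([n] ∖ p) ++ (2n+1 - reverse q), giving the inverse Ψ.
-- Rows: comparing two such columns row by row means comparing the small parts
-- top-aligned and the large parts bottom-aligned (split-rows⇒/⇐), and
-- complements in [n] reverse top-aligned dominance (complement-antitone, by
-- counting entries ≤ t); strictness in P and Q holds as their entries are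
-- distinct.  Content: content-identity relates the x's of R and P to the
-- (2n+1-x)'s of Q; with mult-identity it turns the content of R into "P and Q
-- are permutations of [n]" and back.

open import Defs
open import Data.Bool using (if_then_else_)
open import Data.Empty using (⊥; ⊥-elim)
open import Data.Unit using (⊤; tt)
open import Data.Nat using (ℕ; zero; suc; _+_; _*_; _∸_; _≤_; _<_; _≥_; _>_; _<?_; _≤?_; _≟_; z≤n; s≤s; s≤s⁻¹; z<s)
open import Data.Nat.Properties
open import Algebra.Properties.CommutativeSemigroup +-commutativeSemigroup using (interchange)
open import Data.Product using (_×_; _,_; proj₁; proj₂; uncurry; ∃-syntax)
open import Data.List using (List; []; _∷_; [_]; _++_; length; map; filter; reverse; take; concat; zip; zipWith; upTo; applyUpTo; reverseAcc)
open import Data.List.Properties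
  using (filter-++; filter-accept; filter-reject; filter-all; filter-none; filter-some; length-++; length-map;
         length-reverse; reverse-++; reverse-involutive; reverse-map; unfold-reverse; map-∘; map-id-local;
         map-upTo; length-upTo; map-cong-local; ∷-injectiveˡ; ∷-injectiveʳ; concat-++; ++-assoc; ++-identityʳ)
open import Data.List.Membership.Propositional using (_∈_; _∉_)
open import Data.List.Membership.Propositional.Properties using (∈-filter⁺; ∈-filter⁻; ∈-map⁺; ∈-upTo⁺; ∈-∃++; ∈-++⁺ˡ; ∈-concat⁺′)
open import Data.List.Membership.DecPropositional _≟_ using (_∈?_)
open import Data.List.Relation.Unary.All as All using (All; []; _∷_)
import Data.List.Relation.Unary.All.Properties as Allₚ
open import Data.List.Relation.Unary.Any using (here; there)
open import Data.List.Relation.Unary.AllPairs using (AllPairs; []; _∷_)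
import Data.List.Relation.Unary.AllPairs.Properties as AllPairsₚ
open import Data.List.Relation.Unary.Linked as Linked using (Linked; []; [-]; _∷_)
import Data.List.Relation.Unary.Linked.Properties as Linkedₚ
open import Data.List.Relation.Binary.Pointwise as Pw using (Pointwise; []; _∷_)
open import Data.List.Relation.Binary.Prefix.Heterogeneous as Prefix using (Prefix; []; _∷_)
import Data.List.Relation.Binary.Prefix.Heterogeneous.Properties as Prefixₚ
open import Data.List.Relation.Binary.Suffix.Heterogeneous as Suffix using (Suffix)
import Data.List.Relation.Binary.Suffix.Heterogeneous.Properties as Suffixₚ
open import Data.List.Relation.Binary.Permutation.Propositional using (_↭_; ↭-refl; ↭-sym; ↭-trans; prep)
open import Data.List.Relation.Binary.Permutation.Propositional.Properties
  using (↭-length; filter-↭; shift; ↭-reverse; All-resp-↭; ∈-resp-↭; ++-comm; ++⁺ˡ)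
open import Function using (_∘_; flip; id)
open import Relation.Nullary using (¬_; ¬?; Dec; yes; no; does)
open import Relation.Nullary.Decidable using (dec-true; dec-false; _×-dec_)
open import Relation.Unary using (Decidable)
open import Relation.Binary.PropositionalEquality using (_≡_; _≢_; refl; sym; trans; cong; cong₂; subst; subst₂; module ≡-Reasoning)
open ≡-Reasoning

Sorted : List ℕ → Set
Sorted = AllPairs _<_

Between : ℕ → ℕ → ℕ → Set
Between lo hi x = lo < x × x ≤ hi

between? : (lo hi x : ℕ) → Dec (Between lo hi x)
between? lo hi x = (lo <? x) ×-dec (x ≤? hi)

SubsetOf : ℕ → List ℕ → Set
SubsetOf n s = Sorted s × All (Between 0 n) s

All-reverse : {A : Set} {P : A → Set} {xs : List A} → All P xs → All P (reverse xs)
All-reverse {xs = xs} = All-resp-↭ (↭-sym (↭-reverse xs))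

Linked-map-on : {A : Set} {P : A → Set} {R S : A → A → Set} →
  (∀ {a b} → P a → P b → R a b → S a b) →
  {xs : List A} → All P xs → Linked R xs → Linked S xs
Linked-map-on f _ [] = []
Linked-map-on f _ [-] = [-]
Linked-map-on f (pa ∷ pb ∷ ps) (r ∷ rs) = f pa pb r ∷ Linked-map-on f (pb ∷ ps) rs

Linked-reverse : {A : Set} {R : A → A → Set} {xs : List A} → Linked R xs → Linked (flip R) (reverse xs)
Linked-reverse [] = []
Linked-reverse {R = R} {xs = _ ∷ _} l = go [-] l
  where
  -- invariant of reverse: the accumulator is reversed-linked and ends with y
  go : ∀ {y acc ys} → Linked (flip R) (y ∷ acc) → Linked R (y ∷ ys) →
       Linked (flip R) (reverseAcc (y ∷ acc) ys)
  go done [-] = done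
  go done (r ∷ rs) = go (r ∷ done) rs

take-length-++ : (a b : List ℕ) → take (length a) (a ++ b) ≡ a
take-length-++ [] b = refl
take-length-++ (x ∷ a) b = cong (x ∷_) (take-length-++ a b)

count : {A : Set} {P : A → Set} → Decidable P → List A → ℕ
count P? xs = length (filter P? xs)

count-++ : {A : Set} {P : A → Set} (P? : Decidable P) (xs ys : List A) →
  count P? (xs ++ ys) ≡ count P? xs + count P? ys
count-++ P? xs ys = trans (cong length (filter-++ P? xs ys)) (length-++ (filter P? xs))

count-yes : {A : Set} {P : A → Set} (P? : Decidable P) {x : A} {xs : List A} → P x → count P? (x ∷ xs) ≡ suc (count P? xs)
count-yes P? px = cong length (filter-accept P? px)

count-no : {A : Set} {P : A → Set} (P? : Decidable P) {x : A} {xs : List A} → ¬ P x → count P? (x ∷ xs) ≡ count P? xs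
count-no P? ¬px = cong length (filter-reject P? ¬px)

count-partition : {A : Set} {P Q : A → Set} (Q? : Decidable Q) (P? : Decidable P) (xs : List A) →
  count Q? (filter P? xs) + count Q? (filter (¬? ∘ P?) xs) ≡ count Q? xs
count-partition Q? P? [] = refl
count-partition Q? P? (x ∷ xs) with P? x
... | yes _ with Q? x
...   | yes _ = cong suc (count-partition Q? P? xs)
...   | no _  = count-partition Q? P? xs
count-partition Q? P? (x ∷ xs) | no _ with Q? x
...   | yes _ = trans (+-suc _ _) (cong suc (count-partition Q? P? xs))
...   | no _  = count-partition Q? P? xs

occ-++ : (x : ℕ) (xs ys : List ℕ) → occ x (xs ++ ys) ≡ occ x xs + occ x ys
occ-++ x = count-++ (x ≟_)

occ-↭ : (x : ℕ) {xs ys : List ℕ} → xs ↭ ys → occ x xs ≡ occ x ys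
occ-↭ x p = ↭-length (filter-↭ (x ≟_) p)

occ-here : (x : ℕ) (xs : List ℕ) → occ x (x ∷ xs) ≡ suc (occ x xs)
occ-here x xs = count-yes (x ≟_) {xs = xs} refl

occ-there : (x : ℕ) {y : ℕ} {xs : List ℕ} → x ≢ y → occ x (y ∷ xs) ≡ occ x xs
occ-there x {y} {xs} x≢y = count-no (x ≟_) {y} {xs} x≢y

occ-pos : (x : ℕ) {xs : List ℕ} → x ∈ xs → 0 < occ x xs
occ-pos x = filter-some (x ≟_)

occ-pos⁻¹ : {x : ℕ} (xs : List ℕ) → 0 < occ x xs → x ∈ xs
occ-pos⁻¹ {x} (y ∷ xs) pos with x ≟ y
... | yes x≡y = here x≡y
... | no x≢y  = there (occ-pos⁻¹ xs (subst (0 <_) (occ-there x x≢y) pos))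

occ-absent : (x : ℕ) {xs : List ℕ} → x ∉ xs → occ x xs ≡ 0
occ-absent x {xs} x∉ = cong length (filter-none (x ≟_) (Allₚ.¬Any⇒All¬ xs x∉))

occ-sorted : {x : ℕ} {xs : List ℕ} → Sorted xs → x ∈ xs → occ x xs ≡ 1
occ-sorted {x} {xs = _ ∷ xs} (y< ∷ _) (here refl) =
  trans (occ-here x xs) (cong suc (occ-absent x (λ x∈ → <-irrefl refl (All.lookup y< x∈))))
occ-sorted {x} {y ∷ _} (y< ∷ sorted) (there x∈) with x ≟ y
... | yes refl = ⊥-elim (<-irrefl refl (All.lookup y< x∈))
... | no x≢y   = trans (occ-there x x≢y) (occ-sorted sorted x∈)

occ-map : {f : ℕ → ℕ} {x : ℕ} (l : List ℕ) → (∀ {z} → z ∈ l → f x ≡ f z → x ≡ z) →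
  occ (f x) (map f l) ≡ occ x l
occ-map [] _ = refl
occ-map {f} {x} (z ∷ l) inj with x ≟ z
... | yes refl = trans (occ-here (f x) (map f l)) (trans (cong suc (occ-map l (λ z∈ → inj (there z∈)))) (sym (occ-here x l)))
... | no x≢z   = trans (occ-there (f x) (λ fx≡fz → x≢z (inj (here refl) fx≡fz)))
                   (trans (occ-map l (λ z∈ → inj (there z∈))) (sym (occ-there x x≢z)))

occ-cancel : (y x : ℕ) (a b : List ℕ) → occ y (x ∷ a) ≡ occ y (x ∷ b) → occ y a ≡ occ y b
occ-cancel y x a b eq with y ≟ x
... | yes refl = suc-injective (trans (sym (occ-here y a)) (trans eq (occ-here y b)))
... | no y≢x   = trans (sym (occ-there y y≢x)) (trans eq (occ-there y y≢x))

occ⇒↭ : (xs ys : List ℕ) → (∀ x → occ x xs ≡ occ x ys) → xs ↭ ys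
occ⇒↭ [] [] _ = ↭-refl
occ⇒↭ [] (y ∷ ys) same with trans (same y) (occ-here y ys)
... | ()
occ⇒↭ (x ∷ xs) ys same with ∈-∃++ (occ-pos⁻¹ ys (subst (0 <_) (same x) (occ-pos x (here refl))))
... | us , vs , refl = ↭-trans (prep x (occ⇒↭ xs (us ++ vs) same-rest)) (↭-sym (shift x us vs))
  where
  same-rest : ∀ z → occ z xs ≡ occ z (us ++ vs)
  same-rest z = occ-cancel z x xs (us ++ vs) (trans (same z) (occ-↭ z (shift x us vs)))

concat-reverse-↭ : (T : Tableau) → concat (reverse T) ↭ concat T
concat-reverse-↭ [] = ↭-refl
concat-reverse-↭ (c ∷ T) =
  subst (_↭ c ++ concat T) (sym last-column-last)
    (↭-trans (++-comm (concat (reverse T)) c) (++⁺ˡ c (concat-reverse-↭ T)))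
  where
  last-column-last : concat (reverse (c ∷ T)) ≡ concat (reverse T) ++ c
  last-column-last = begin
    concat (reverse (c ∷ T))         ≡⟨ cong concat (unfold-reverse c T) ⟩
    concat (reverse T ++ [ c ])      ≡⟨ concat-++ (reverse T) [ c ] ⟨
    concat (reverse T) ++ c ++ []    ≡⟨ cong (concat (reverse T) ++_) (++-identityʳ c) ⟩
    concat (reverse T) ++ c          ∎

oneTo-sorted : (n : ℕ) → Sorted (oneTo n)
oneTo-sorted n = AllPairsₚ.map⁺ (AllPairsₚ.applyUpTo⁺₁ id n (λ i<j _ → s≤s i<j))

oneTo-between : (n : ℕ) → All (Between 0 n) (oneTo n)
oneTo-between n = Allₚ.map⁺ (Allₚ.applyUpTo⁺₁ id n (λ i<n → z<s , i<n))

between⇒∈oneTo : {n x : ℕ} → Between 0 n x → x ∈ oneTo n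
between⇒∈oneTo {x = suc i} (_ , i<n) = ∈-map⁺ suc (∈-upTo⁺ i<n)

occ-oneTo-in : {n x : ℕ} → Between 0 n x → occ x (oneTo n) ≡ 1
occ-oneTo-in {n} b = occ-sorted (oneTo-sorted n) (between⇒∈oneTo b)

occ-oneTo-out : {n x : ℕ} → ¬ Between 0 n x → occ x (oneTo n) ≡ 0
occ-oneTo-out {n} {x} nb = occ-absent x (λ x∈ → nb (All.lookup (oneTo-between n) x∈))

occ-oneTo≤1 : (n x : ℕ) → occ x (oneTo n) ≤ 1
occ-oneTo≤1 n x with between? 0 n x
... | yes b = ≤-reflexive (occ-oneTo-in b)
... | no nb = ≤-trans (≤-reflexive (occ-oneTo-out nb)) z≤n

occ-outside : {n x : ℕ} {l : List ℕ} → All (Between 0 n) l → ¬ Between 0 n x → occ x l ≡ occ x (oneTo n)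
occ-outside {x = x} inside nb =
  trans (occ-absent x (λ x∈ → nb (All.lookup inside x∈))) (sym (occ-oneTo-out nb))

sorted-heads : {x y : ℕ} {xs ys : List ℕ} → All (x <_) xs → All (y <_) ys →
  x ∈ y ∷ ys → y ∈ x ∷ xs → x ≡ y
sorted-heads _ _ (here x≡y) _ = x≡y
sorted-heads _ _ (there _) (here y≡x) = sym y≡x
sorted-heads x< y< (there x∈ys) (there y∈xs) = ⊥-elim (<-asym (All.lookup x< y∈xs) (All.lookup y< x∈ys))

sorted-ext : {xs ys : List ℕ} → Sorted xs → Sorted ys →
  (∀ {z} → z ∈ xs → z ∈ ys) → (∀ {z} → z ∈ ys → z ∈ xs) → xs ≡ ys
sorted-ext {[]} {[]} _ _ _ _ = refl
sorted-ext {[]} {y ∷ ys} _ _ _ ys⊆ with ys⊆ (here refl)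
... | ()
sorted-ext {x ∷ xs} {[]} _ _ xs⊆ _ with xs⊆ (here refl)
... | ()
sorted-ext {x ∷ xs} {y ∷ ys} (x< ∷ sx) (y< ∷ sy) xs⊆ ys⊆ with sorted-heads x< y< (xs⊆ (here refl)) (ys⊆ (here refl))
... | refl = cong (x ∷_) (sorted-ext sx sy (drop-head x< xs⊆) (drop-head y< ys⊆))
  where
  drop-head : {u : ℕ} {us vs : List ℕ} → All (u <_) us →
    (∀ {z} → z ∈ u ∷ us → z ∈ u ∷ vs) → ∀ {z} → z ∈ us → z ∈ vs
  drop-head u< sub z∈ with sub (there z∈)
  ... | here refl = ⊥-elim (<-irrefl refl (All.lookup u< z∈))
  ... | there z∈vs = z∈vs

complement : ℕ → List ℕ → List ℕ
complement n s = filter (λ x → ¬? (x ∈? s)) (oneTo n)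

∈-complement⁻ : (n : ℕ) (s : List ℕ) {z : ℕ} → z ∈ complement n s → z ∈ oneTo n × z ∉ s
∈-complement⁻ n s = ∈-filter⁻ (λ x → ¬? (x ∈? s)) {xs = oneTo n}

∈-complement⁺ : (n : ℕ) (s : List ℕ) {z : ℕ} → z ∈ oneTo n → z ∉ s → z ∈ complement n s
∈-complement⁺ n s = ∈-filter⁺ (λ x → ¬? (x ∈? s)) {xs = oneTo n}

complement-subset : (n : ℕ) (s : List ℕ) → SubsetOf n (complement n s)
complement-subset n s = AllPairsₚ.filter⁺ _ (oneTo-sorted n) , Allₚ.filter⁺ _ (oneTo-between n)

select-oneTo : {n : ℕ} {s : List ℕ} → SubsetOf n s → filter (_∈? s) (oneTo n) ≡ s
select-oneTo {n} {s} (sorted , inside) = sorted-ext (AllPairsₚ.filter⁺ _ (oneTo-sorted n)) sorted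
  (λ z∈ → proj₂ (∈-filter⁻ (_∈? s) {xs = oneTo n} z∈))
  (λ z∈ → ∈-filter⁺ (_∈? s) {xs = oneTo n} (between⇒∈oneTo (All.lookup inside z∈)) z∈)

complement-involutive : {n : ℕ} {s : List ℕ} → SubsetOf n s → complement n (complement n s) ≡ s
complement-involutive {n} {s} (sorted , inside) =
  sorted-ext (proj₁ (complement-subset n _)) sorted ⊆s s⊆
  where
  ⊆s : ∀ {z} → z ∈ complement n (complement n s) → z ∈ s
  ⊆s {z} z∈ with z ∈? s
  ... | yes z∈s = z∈s
  ... | no z∉s  = ⊥-elim (proj₂ (∈-complement⁻ n _ z∈) (∈-complement⁺ n s (proj₁ (∈-complement⁻ n _ z∈)) z∉s))
  s⊆ : ∀ {z} → z ∈ s → z ∈ complement n (complement n s)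
  s⊆ z∈ = ∈-complement⁺ n _ (between⇒∈oneTo (All.lookup inside z∈)) (λ z∈c → proj₂ (∈-complement⁻ n s z∈c) z∈)

count-complement : {Q : ℕ → Set} (Q? : Decidable Q) {n : ℕ} {s : List ℕ} → SubsetOf n s →
  count Q? (complement n s) + count Q? s ≡ count Q? (oneTo n)
count-complement Q? {n} {s} sub = begin
  count Q? (complement n s) + count Q? s                              ≡⟨ +-comm _ (count Q? s) ⟩
  count Q? s + count Q? (complement n s)                              ≡⟨ cong (λ t → count Q? t + count Q? (complement n s)) (select-oneTo sub) ⟨
  count Q? (filter (_∈? s) (oneTo n)) + count Q? (complement n s)     ≡⟨ count-partition Q? (_∈? s) (oneTo n) ⟩
  count Q? (oneTo n)                                                  ∎

length-complement : {n : ℕ} {s : List ℕ} → SubsetOf n s → length (complement n s) + length s ≡ n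
length-complement {n} {s} sub = begin
  length (complement n s) + length s               ≡⟨ cong₂ _+_ (count-all (complement n s)) (count-all s) ⟨
  count always (complement n s) + count always s   ≡⟨ count-complement always sub ⟩
  count always (oneTo n)                           ≡⟨ count-all (oneTo n) ⟩
  length (oneTo n)                                 ≡⟨ length-map suc (upTo n) ⟩
  length (upTo n)                                  ≡⟨ length-upTo n ⟩
  n                                                ∎
  where
  always : Decidable (λ (_ : ℕ) → ⊤)
  always _ = yes tt
  count-all : (xs : List ℕ) → count always xs ≡ length xs
  count-all xs = cong length (filter-all always (All.universal (λ _ → tt) xs))

-- Prefix _≥_ b a : the column b can stand right of the column a in a
-- tableau with weakly increasing rows (b is no longer than a and
-- b[k] ≥ a[k] in every row k of b).

none-below : {y t : ℕ} {l : List ℕ} → All (y <_) l → ¬ y ≤ t → count (_≤? t) l ≡ 0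
none-below y< y≰t = cong length (filter-none (_≤? _) (All.map (λ y<z z≤t → y≰t (≤-trans (<⇒≤ y<z) z≤t)) y<))

dominance⇒count : {a b : List ℕ} → Sorted b → Prefix _≥_ b a →
  ∀ t → count (_≤? t) b ≤ count (_≤? t) a
dominance⇒count _ [] t = z≤n
dominance⇒count {x ∷ a} {y ∷ b} (y< ∷ sorted) (x≤y ∷ p) t with y ≤? t
... | yes y≤t = subst₂ _≤_ (sym (count-yes (_≤? t) y≤t)) (sym (count-yes (_≤? t) (≤-trans x≤y y≤t)))
                  (s≤s (dominance⇒count sorted p t))
... | no y≰t = subst (_≤ count (_≤? t) (x ∷ a)) (sym (trans (count-no (_≤? t) y≰t) (none-below y< y≰t))) z≤n

count⇒dominance : {a b : List ℕ} → Sorted a → Sorted b →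
  (∀ t → count (_≤? t) b ≤ count (_≤? t) a) → Prefix _≥_ b a
count⇒dominance {b = []} _ _ _ = []
count⇒dominance {[]} {y ∷ b} _ _ fewer with subst (_≤ 0) (count-yes (_≤? y) ≤-refl) (fewer y)
... | ()
count⇒dominance {x ∷ a} {y ∷ b} (x< ∷ sa) (y< ∷ sb) fewer with x ≤? y
... | yes x≤y = x≤y ∷ count⇒dominance sa sb fewer-tail
  where
  fewer-tail : ∀ t → count (_≤? t) b ≤ count (_≤? t) a
  fewer-tail t with y ≤? t
  ... | yes y≤t = s≤s⁻¹ (subst₂ _≤_ (count-yes (_≤? t) y≤t) (count-yes (_≤? t) (≤-trans x≤y y≤t)) (fewer t))
  ... | no y≰t = subst (_≤ count (_≤? t) a) (sym (none-below y< y≰t)) z≤n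
... | no x≰y with subst₂ _≤_ (count-yes (_≤? y) ≤-refl) (trans (count-no (_≤? y) x≰y) (none-below x< x≰y)) (fewer y)
...   | ()

+-≡-antitone : {a x b y : ℕ} → a + x ≡ b + y → y ≤ x → a ≤ b
+-≡-antitone {a} {x} {b} {y} eq y≤x = +-cancelʳ-≤ x a b (subst (_≤ b + x) (sym eq) (+-monoʳ-≤ b y≤x))

complement-antitone : {n : ℕ} {s s' : List ℕ} → SubsetOf n s → SubsetOf n s' →
  Prefix _≥_ s' s → Prefix _≥_ (complement n s) (complement n s')
complement-antitone {n} {s} {s'} sub sub' dom =
  count⇒dominance (proj₁ (complement-subset n s')) (proj₁ (complement-subset n s)) λ t →
    +-≡-antitone (trans (count-complement (_≤? t) sub) (sym (count-complement (_≤? t) sub')))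
                 (dominance⇒count (proj₁ sub') dom t)

separated-rows : {n : ℕ} {u v : List ℕ} → All (n <_) u → All (_≤ n) v →
  length u ≡ length v → Pointwise _≥_ u v
separated-rows {u = []} {[]} _ _ _ = []
separated-rows {u = _ ∷ _} {_ ∷ _} (n<x ∷ u>) (y≤n ∷ v≤) eq =
  <⇒≤ (≤-<-trans y≤n n<x) ∷ separated-rows u> v≤ (suc-injective eq)

Pointwise-++⇒Prefix : {R : ℕ → ℕ → Set} {a b c d : List ℕ} →
  Pointwise R (a ++ b) (c ++ d) → length a ≤ length c → Prefix R a c
Pointwise-++⇒Prefix {a = []} _ _ = []
Pointwise-++⇒Prefix {a = _ ∷ _} {c = _ ∷ _} (r ∷ rs) (s≤s le) = r ∷ Pointwise-++⇒Prefix rs le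

Pointwise-++⇒Suffix : {R : ℕ → ℕ → Set} {a b c d : List ℕ} →
  Pointwise R (a ++ b) (c ++ d) → length b ≤ length d → Suffix R b d
Pointwise-++⇒Suffix {R} {a} {b} {c} {d} rs le = Suffixₚ.fromPrefix-rev (Pointwise-++⇒Prefix reversed le′)
  where
  reversed : Pointwise R (reverse b ++ reverse a) (reverse d ++ reverse c)
  reversed = subst₂ (Pointwise R) (reverse-++ a b) (reverse-++ c d) (Pw.reverse⁺ rs)
  le′ : length (reverse b) ≤ length (reverse d)
  le′ = subst₂ _≤_ (sym (length-reverse b)) (sym (length-reverse d)) le

top-part-length : {n : ℕ} (s l s' l' : List ℕ) → All (_≤ n) s' → All (n <_) l →
  Pointwise _≥_ (s' ++ l') (s ++ l) → length s' ≤ length s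
top-part-length s l [] l' _ _ _ = z≤n
top-part-length [] (z ∷ l) (y ∷ s') l' (y≤n ∷ _) (n<z ∷ _) (z≤y ∷ _) =
  ⊥-elim (<-irrefl refl (<-≤-trans n<z (≤-trans z≤y y≤n)))
top-part-length (x ∷ s) l (y ∷ s') l' (_ ∷ s'≤) l> (_ ∷ rs) = s≤s (top-part-length s l s' l' s'≤ l> rs)

split-rows⇒ : {n : ℕ} (s l s' l' : List ℕ) → All (_≤ n) s' → All (n <_) l →
  Pointwise _≥_ (s' ++ l') (s ++ l) → Prefix _≥_ s' s × Suffix _≤_ l l'
split-rows⇒ s l s' l' s'≤ l> rs =
  Pointwise-++⇒Prefix rs top , Pointwise-++⇒Suffix (Pw.symmetric id rs) bottom
  where
  top : length s' ≤ length s
  top = top-part-length s l s' l' s'≤ l> rs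
  lengths : length l + length s ≡ length l' + length s'
  lengths = begin
    length l + length s    ≡⟨ +-comm (length l) _ ⟩
    length s + length l    ≡⟨ length-++ s ⟨
    length (s ++ l)        ≡⟨ Pw.Pointwise-length rs ⟨
    length (s' ++ l')      ≡⟨ length-++ s' ⟩
    length s' + length l'  ≡⟨ +-comm (length s') _ ⟩
    length l' + length s'  ∎
  bottom : length l ≤ length l'
  bottom = +-≡-antitone lengths top

split-rows⇐ : {n : ℕ} (s l s' l' : List ℕ) → All (_≤ n) s → All (n <_) l' →
  length (s' ++ l') ≡ length (s ++ l) →
  Prefix _≥_ s' s → Suffix _≤_ l l' → Pointwise _≥_ (s' ++ l') (s ++ l)
split-rows⇐ s l s' l' s≤ l'> len top bottom with Prefix.toView top | Suffix.toView bottom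
... | Prefix._++_ {u} top-rows v | Suffix._++_ x {y} bottom-rows =
  subst (Pointwise _≥_ (s' ++ x ++ y)) (sym (++-assoc u v l))
    (Pw.++⁺ top-rows (Pw.++⁺ middle-rows (Pw.symmetric id bottom-rows)))
  where
  middle-length : length x ≡ length v
  middle-length = +-cancelʳ-≡ (length l) _ _ (+-cancelˡ-≡ (length s') _ _ (begin
    length s' + (length x + length l)  ≡⟨ cong (λ k → length s' + (length x + k)) (Pw.Pointwise-length bottom-rows) ⟩
    length s' + (length x + length y)  ≡⟨ cong (length s' +_) (length-++ x) ⟨
    length s' + length (x ++ y)        ≡⟨ length-++ s' ⟨
    length (s' ++ x ++ y)              ≡⟨ len ⟩
    length ((u ++ v) ++ l)             ≡⟨ cong length (++-assoc u v l) ⟩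
    length (u ++ v ++ l)               ≡⟨ length-++ u ⟩
    length u + length (v ++ l)         ≡⟨ cong₂ _+_ (sym (Pw.Pointwise-length top-rows)) (length-++ v) ⟩
    length s' + (length v + length l)  ∎))
  middle-rows : Pointwise _≥_ x v
  middle-rows = separated-rows (Allₚ.++⁻ˡ x l'>) (Allₚ.++⁻ʳ u s≤) middle-length

mirror : ℕ → ℕ → ℕ
mirror n x = n + n + 1 ∸ x

2n+1≡ : (n : ℕ) → n + n + 1 ≡ suc (n + n)
2n+1≡ n = +-comm (n + n) 1

mirror-suc : (n x : ℕ) → mirror n (suc x) ≡ n + n ∸ x
mirror-suc n x = cong (_∸ suc x) (2n+1≡ n)

mirror-involutive : (n : ℕ) {x : ℕ} → x ≤ n + n + 1 → mirror n (mirror n x) ≡ x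
mirror-involutive n = m∸[m∸n]≡n

mirror-antitone : {n x y : ℕ} → x ≤ y → mirror n y ≤ mirror n x
mirror-antitone {n} = ∸-monoʳ-≤ (n + n + 1)

between-2n+1 : (n : ℕ) {x : ℕ} → Between 0 (n + n) x → x ≤ n + n + 1
between-2n+1 n (_ , x≤) = ≤-trans x≤ (m≤m+n (n + n) 1)

large⇒between : {n x : ℕ} → Between n (n + n) x → Between 0 (n + n) x
large⇒between (n<x , x≤) = ≤-<-trans z≤n n<x , x≤

small⇒between : {n x : ℕ} → Between 0 n x → Between 0 (n + n) x
small⇒between {n} (0<x , x≤) = 0<x , ≤-trans x≤ (m≤m+n n n)

mirror-small : {n x : ℕ} → Between 0 n x → Between n (n + n) (mirror n x)
mirror-small {n} {suc x} (_ , x<n) rewrite mirror-suc n x =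
  m+n≤o⇒m≤o∸n (suc n) (subst (_≤ n + n) (+-suc n x) (+-monoʳ-≤ n x<n)) , m∸n≤m (n + n) x

mirror-large : {n x : ℕ} → Between n (n + n) x → Between 0 n (mirror n x)
mirror-large {n} {suc x} (n<x , x<2n) rewrite mirror-suc n x =
  m<n⇒0<n∸m x<2n , m≤n+o⇒m∸n≤o (n + n) x (+-monoˡ-≤ n (s≤s⁻¹ n<x))

mirror-pos : (n : ℕ) {z : ℕ} → z ≤ n + n → 0 < mirror n z
mirror-pos n {z} z≤ = m<n⇒0<n∸m (subst (z <_) (sym (2n+1≡ n)) (s≤s z≤))

mirror-pos⁻¹ : (n : ℕ) {x : ℕ} → 0 < mirror n x → x ≤ n + n
mirror-pos⁻¹ n {x} pos with x ≤? n + n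
... | yes x≤ = x≤
... | no x≰ = ⊥-elim (<-irrefl refl (subst (0 <_) (m≤n⇒m∸n≡0 2n+1≤x) pos))
  where
  2n+1≤x : n + n + 1 ≤ x
  2n+1≤x = subst (_≤ x) (sym (2n+1≡ n)) (≰⇒> x≰)

mirror-small-not-small : {n x : ℕ} → Between 0 n x → ¬ Between 0 n (mirror n x)
mirror-small-not-small small b = <⇒≱ (proj₁ (mirror-small small)) (proj₂ b)

mirror-small⁻¹ : {n x : ℕ} → Between 0 n (mirror n x) → Between n (n + n) x
mirror-small⁻¹ {n} {x} b =
  subst (Between n (n + n)) (mirror-involutive n (≤-trans (mirror-pos⁻¹ n (proj₁ b)) (m≤m+n (n + n) 1))) (mirror-small b)

mirror-injective : {n y z : ℕ} → Between 0 (n + n) z → mirror n y ≡ mirror n z → y ≡ z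
mirror-injective {n} {y} {z} z-in eq = begin
  y                    ≡⟨ mirror-involutive n y≤ ⟨
  mirror n (mirror n y) ≡⟨ cong (mirror n) eq ⟩
  mirror n (mirror n z) ≡⟨ mirror-involutive n (between-2n+1 n z-in) ⟩
  z                    ∎
  where
  y≤ : y ≤ n + n + 1
  y≤ = ≤-trans (mirror-pos⁻¹ n (subst (0 <_) (sym eq) (mirror-pos n (proj₂ z-in)))) (m≤m+n (n + n) 1)

mirror-reverse-sorted : (n : ℕ) {l : List ℕ} → All (Between 0 (n + n)) l → Sorted l →
  Sorted (map (mirror n) (reverse l))
mirror-reverse-sorted n inside sorted =
  Linkedₚ.Linked⇒AllPairs <-trans (Linkedₚ.map⁺ (Linked-map-on decreasing (All-reverse inside)
    (Linked-reverse (Linkedₚ.AllPairs⇒Linked sorted))))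
  where
  decreasing : {a b : ℕ} → Between 0 (n + n) a → Between 0 (n + n) b → b < a → mirror n a < mirror n b
  decreasing a-in _ b<a = ∸-monoʳ-< b<a (between-2n+1 n a-in)

mirror-reverse-involutive : (n : ℕ) {l : List ℕ} → All (Between 0 (n + n)) l →
  map (mirror n) (reverse (map (mirror n) (reverse l))) ≡ l
mirror-reverse-involutive n {l} inside = begin
  map (mirror n) (reverse (map (mirror n) (reverse l)))   ≡⟨ cong (map (mirror n)) (reverse-map (mirror n) (reverse l)) ⟨
  map (mirror n) (map (mirror n) (reverse (reverse l)))   ≡⟨ cong (map (mirror n) ∘ map (mirror n)) (reverse-involutive l) ⟩
  map (mirror n) (map (mirror n) l)                       ≡⟨ map-∘ l ⟨
  map (mirror n ∘ mirror n) l                             ≡⟨ map-id-local (All.map (mirror-involutive n ∘ between-2n+1 n) inside) ⟩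
  l                                                       ∎

mult-small : {w n x : ℕ} → Between 0 n x → mult w n x ≡ w ∸ 1
mult-small {w} {n} {suc x} (_ , x≤n) =
  cong (λ b → if b then w ∸ 1 else (if does (suc x ≤? n + n) then 1 else 0)) (dec-true (suc x ≤? n) x≤n)

mult-large : {w n x : ℕ} → Between n (n + n) x → mult w n x ≡ 1
mult-large {w} {n} {suc x} (n<x , x≤2n) =
  trans (cong (λ b → if b then w ∸ 1 else (if does (suc x ≤? n + n) then 1 else 0)) (dec-false (suc x ≤? n) (<⇒≱ n<x)))
        (cong (λ b → if b then 1 else 0) (dec-true (suc x ≤? n + n) x≤2n))

mult-outside : {w n x : ℕ} → ¬ Between 0 (n + n) x → mult w n x ≡ 0
mult-outside {x = zero} _ = refl
mult-outside {w} {n} {suc x} out =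
  trans (cong (λ b → if b then w ∸ 1 else (if does (suc x ≤? n + n) then 1 else 0))
          (dec-false (suc x ≤? n) (λ x≤n → out (z<s , ≤-trans x≤n (m≤m+n n n)))))
        (cong (λ b → if b then 1 else 0) (dec-false (suc x ≤? n + n) (λ x≤2n → out (z<s , x≤2n))))

mult-support : {w n x : ℕ} → 0 < mult w n x → Between 0 (n + n) x
mult-support {w} {n} {x} pos with between? 0 (n + n) x
... | yes inside = inside
... | no outside = ⊥-elim (<-irrefl refl (subst (0 <_) (mult-outside outside) pos))

neither-small-nor-large : {n x : ℕ} → ¬ Between 0 n x → ¬ Between n (n + n) x → ¬ Between 0 (n + n) x
neither-small-nor-large {n} {x} not-small not-large (0<x , x≤2n) with x ≤? n
... | yes x≤n = not-small (0<x , x≤n)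
... | no x≰n  = not-large (≰⇒> x≰n , x≤2n)

mult-identity : {w n : ℕ} → 1 ≤ w → ∀ x →
  mult w n x + occ x (oneTo n) ≡ w * occ x (oneTo n) + occ (mirror n x) (oneTo n)
mult-identity {w} {n} 1≤w x with between? 0 n x
... | yes small = begin
  mult w n x + occ x (oneTo n)                         ≡⟨ cong₂ _+_ (mult-small small) (occ-oneTo-in small) ⟩
  w ∸ 1 + 1                                            ≡⟨ trans (+-comm (w ∸ 1) 1) (m+[n∸m]≡n 1≤w) ⟩
  w                                                    ≡⟨ trans (+-identityʳ (w * 1)) (*-identityʳ w) ⟨
  w * 1 + 0                                            ≡⟨ cong₂ (λ k m → w * k + m) (occ-oneTo-in small) (occ-oneTo-out (mirror-small-not-small small)) ⟨
  w * occ x (oneTo n) + occ (mirror n x) (oneTo n)     ∎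
... | no not-small with between? n (n + n) x
...   | yes large = begin
  mult w n x + occ x (oneTo n)                         ≡⟨ cong₂ _+_ (mult-large large) (occ-oneTo-out not-small) ⟩
  1                                                    ≡⟨ cong (_+ 1) (*-zeroʳ w) ⟨
  w * 0 + 1                                            ≡⟨ cong₂ (λ k m → w * k + m) (occ-oneTo-out not-small) (occ-oneTo-in (mirror-large large)) ⟨
  w * occ x (oneTo n) + occ (mirror n x) (oneTo n)     ∎
...   | no not-large = begin
  mult w n x + occ x (oneTo n)                         ≡⟨ cong₂ _+_ (mult-outside (neither-small-nor-large not-small not-large)) (occ-oneTo-out not-small) ⟩
  0                                                    ≡⟨ trans (+-identityʳ (w * 0)) (*-zeroʳ w) ⟨
  w * 0 + 0                                            ≡⟨ cong₂ (λ k m → w * k + m) (occ-oneTo-out not-small) (occ-oneTo-out (not-large ∘ mirror-small⁻¹)) ⟨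
  w * occ x (oneTo n) + occ (mirror n x) (oneTo n)     ∎

RColumn : ℕ → Column → Set
RColumn n c = Sorted c × length c ≡ n × All (Between 0 (n + n)) c

small large : ℕ → Column → Column
small n c = filter (_≤? n) c
large n c = filter (n <?_) c

qcol mcol pcol : ℕ → Column → Column
qcol n c = map (mirror n) (reverse (large n c))
mcol n c = take (n ∸ length (qcol n c)) c
pcol n c = complement n (mcol n c)

mkColumn : ℕ → Column → Column → Column
mkColumn n p q = complement n p ++ map (mirror n) (reverse q)

split-sorted : (n : ℕ) {c : Column} → Sorted c → small n c ++ large n c ≡ c
split-sorted n {[]} [] = refl
split-sorted n {x ∷ c} (x< ∷ sorted) with x ≤? n
... | yes x≤n = trans (cong₂ _++_ (filter-accept (_≤? n) x≤n) (filter-reject (n <?_) (≤⇒≯ x≤n)))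
                      (cong (x ∷_) (split-sorted n sorted))
... | no x≰n  = cong₂ _++_
  (trans (filter-reject (_≤? n) x≰n) (filter-none (_≤? n) (All.map (λ x<y y≤n → x≰n (≤-trans (<⇒≤ x<y) y≤n)) x<)))
  (filter-all (n <?_) (≰⇒> x≰n ∷ All.map (<-trans (≰⇒> x≰n)) x<))

small-++ : {n : ℕ} {s l : List ℕ} → All (_≤ n) s → All (n <_) l → small n (s ++ l) ≡ s
small-++ {n} {s} {l} s≤ l> = begin
  small n (s ++ l)            ≡⟨ filter-++ (_≤? n) s l ⟩
  small n s ++ small n l      ≡⟨ cong₂ _++_ (filter-all (_≤? n) s≤) (filter-none (_≤? n) (All.map <⇒≱ l>)) ⟩
  s ++ []                     ≡⟨ ++-identityʳ s ⟩
  s                           ∎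

large-++ : {n : ℕ} {s l : List ℕ} → All (_≤ n) s → All (n <_) l → large n (s ++ l) ≡ l
large-++ {n} {s} {l} s≤ l> = begin
  large n (s ++ l)            ≡⟨ filter-++ (n <?_) s l ⟩
  large n s ++ large n l      ≡⟨ cong₂ _++_ (filter-none (n <?_) (All.map ≤⇒≯ s≤)) (filter-all (n <?_) l>) ⟩
  l                           ∎

module _ {n : ℕ} {c : Column} (rc : RColumn n c) where
  private
    sorted : Sorted c
    sorted = proj₁ rc
    inside : All (Between 0 (n + n)) c
    inside = proj₂ (proj₂ rc)

  small-subset : SubsetOf n (small n c)
  small-subset = AllPairsₚ.filter⁺ (_≤? n) sorted
    , All.zipWith (λ (x-in , x≤n) → proj₁ x-in , x≤n) (Allₚ.filter⁺ (_≤? n) inside , Allₚ.all-filter (_≤? n) c)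

  large-between : All (Between n (n + n)) (large n c)
  large-between = All.zipWith (λ (x-in , n<x) → n<x , proj₂ x-in) (Allₚ.filter⁺ (n <?_) inside , Allₚ.all-filter (n <?_) c)

  qcol-subset : SubsetOf n (qcol n c)
  qcol-subset = mirror-reverse-sorted n (All.map (large⇒between {n}) large-between) (AllPairsₚ.filter⁺ (n <?_) sorted)
    , Allₚ.gmap⁺ mirror-large (All-reverse large-between)

  length-qcol : length (qcol n c) ≡ length (large n c)
  length-qcol = trans (length-map (mirror n) (reverse (large n c))) (length-reverse (large n c))

  length-small-large : length (small n c) + length (large n c) ≡ n
  length-small-large = trans (sym (length-++ (small n c))) (trans (cong length (split-sorted n sorted)) (proj₁ (proj₂ rc)))

  mcol-small : mcol n c ≡ small n c
  mcol-small = begin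
    take (n ∸ length (qcol n c)) c                     ≡⟨ cong (λ k → take (n ∸ k) c) length-qcol ⟩
    take (n ∸ length (large n c)) c                    ≡⟨ cong (λ k → take (k ∸ length (large n c)) c) length-small-large ⟨
    take (length (small n c) + length (large n c) ∸ length (large n c)) c
                                                       ≡⟨ cong (λ k → take k c) (m+n∸n≡m (length (small n c)) (length (large n c))) ⟩
    take (length (small n c)) c                        ≡⟨ cong (take (length (small n c))) (split-sorted n sorted) ⟨
    take (length (small n c)) (small n c ++ large n c) ≡⟨ take-length-++ (small n c) (large n c) ⟩
    small n c                                          ∎

  pcol-small : pcol n c ≡ complement n (small n c)
  pcol-small = cong (complement n) mcol-small

  column-shape : length (pcol n c) ≡ length (qcol n c)
  column-shape = begin
    length (pcol n c)                  ≡⟨ cong length pcol-small ⟩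
    length (complement n (small n c))  ≡⟨ +-cancelʳ-≡ (length (small n c)) _ _ lengths ⟩
    length (large n c)                 ≡⟨ length-qcol ⟨
    length (qcol n c)                  ∎
    where
    lengths : length (complement n (small n c)) + length (small n c) ≡ length (large n c) + length (small n c)
    lengths = trans (length-complement small-subset)
                (trans (sym length-small-large) (+-comm (length (small n c)) _))

  mkColumn-pcol-qcol : mkColumn n (pcol n c) (qcol n c) ≡ c
  mkColumn-pcol-qcol = begin
    complement n (pcol n c) ++ map (mirror n) (reverse (qcol n c))
      ≡⟨ cong₂ _++_ (trans (cong (complement n) pcol-small) (complement-involutive small-subset))
                    (mirror-reverse-involutive n (All.map (large⇒between {n}) large-between)) ⟩
    small n c ++ large n c
      ≡⟨ split-sorted n sorted ⟩
    c ∎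

ColumnPair : ℕ → Column → Column → Set
ColumnPair n p q = SubsetOf n p × SubsetOf n q × length p ≡ length q

module _ {n : ℕ} {p q : Column} (pair : ColumnPair n p q) where
  private
    q-subset : SubsetOf n q
    q-subset = proj₁ (proj₂ pair)

  complement-small : All (_≤ n) (complement n p)
  complement-small = All.map proj₂ (proj₂ (complement-subset n p))

  mirror-q-large : All (Between n (n + n)) (map (mirror n) (reverse q))
  mirror-q-large = Allₚ.gmap⁺ mirror-small (All-reverse (proj₂ q-subset))

  mkColumn-RColumn : RColumn n (mkColumn n p q)
  mkColumn-RColumn = sorted , length-n , inside
    where
    sorted : Sorted (mkColumn n p q)
    sorted = AllPairsₚ.++⁺ (proj₁ (complement-subset n p))
      (mirror-reverse-sorted n (All.map (small⇒between {n}) (proj₂ q-subset)) (proj₁ q-subset))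
      (All.map (λ x≤n → All.map (λ large-y → ≤-<-trans x≤n (proj₁ large-y)) mirror-q-large) complement-small)
    length-n : length (mkColumn n p q) ≡ n
    length-n = begin
      length (mkColumn n p q)                                    ≡⟨ length-++ (complement n p) ⟩
      length (complement n p) + length (map (mirror n) (reverse q)) ≡⟨ cong (length (complement n p) +_)
                                                                       (trans (length-map (mirror n) (reverse q)) (length-reverse q)) ⟩
      length (complement n p) + length q                         ≡⟨ cong (length (complement n p) +_) (proj₂ (proj₂ pair)) ⟨
      length (complement n p) + length p                         ≡⟨ length-complement (proj₁ pair) ⟩
      n                                                          ∎
    inside : All (Between 0 (n + n)) (mkColumn n p q)
    inside = Allₚ.++⁺ (All.map (small⇒between {n}) (proj₂ (complement-subset n p))) (All.map (large⇒between {n}) mirror-q-large)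

  pcol-mkColumn : pcol n (mkColumn n p q) ≡ p
  pcol-mkColumn = begin
    pcol n (mkColumn n p q)                     ≡⟨ pcol-small mkColumn-RColumn ⟩
    complement n (small n (mkColumn n p q))     ≡⟨ cong (complement n) (small-++ complement-small (All.map proj₁ mirror-q-large)) ⟩
    complement n (complement n p)               ≡⟨ complement-involutive (proj₁ pair) ⟩
    p                                           ∎

  qcol-mkColumn : qcol n (mkColumn n p q) ≡ q
  qcol-mkColumn = begin
    map (mirror n) (reverse (large n (mkColumn n p q)))          ≡⟨ cong (map (mirror n) ∘ reverse)
                                                                      (large-++ complement-small (All.map proj₁ mirror-q-large)) ⟩
    map (mirror n) (reverse (map (mirror n) (reverse q)))         ≡⟨ mirror-reverse-involutive n (All.map (small⇒between {n}) (proj₂ q-subset)) ⟩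
    q                                                              ∎

column-content : {n : ℕ} {c : Column} → RColumn n c → ∀ x →
  occ x c + occ x (pcol n c) ≡ occ x (oneTo n) + occ (mirror n x) (qcol n c)
column-content {n} {c} rc x = begin
  occ x c + occ x (pcol n c)
    ≡⟨ cong₂ _+_ (cong (occ x) (sym (split-sorted n (proj₁ rc)))) (cong (occ x) (pcol-small rc)) ⟩
  occ x (small n c ++ large n c) + occ x (complement n (small n c))
    ≡⟨ cong (_+ occ x (complement n (small n c))) (occ-++ x (small n c) (large n c)) ⟩
  occ x (small n c) + occ x (large n c) + occ x (complement n (small n c))
    ≡⟨ +-comm _ (occ x (complement n (small n c))) ⟩
  occ x (complement n (small n c)) + (occ x (small n c) + occ x (large n c))
    ≡⟨ +-assoc (occ x (complement n (small n c))) _ _ ⟨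
  occ x (complement n (small n c)) + occ x (small n c) + occ x (large n c)
    ≡⟨ cong₂ _+_ (count-complement (x ≟_) (small-subset rc)) (sym occ-qcol) ⟩
  occ x (oneTo n) + occ (mirror n x) (qcol n c)
    ∎
  where
  occ-qcol : occ (mirror n x) (qcol n c) ≡ occ x (large n c)
  occ-qcol = trans
    (occ-map (reverse (large n c)) (λ z∈ → mirror-injective {n} (large⇒between {n} (All.lookup (All-reverse (large-between rc)) z∈))))
    (occ-↭ x (↭-reverse (large n c)))

content-identity : {n : ℕ} {T : Tableau} → All (RColumn n) T → ∀ x →
  occ x (concat T) + occ x (concat (map (pcol n) T))
    ≡ length T * occ x (oneTo n) + occ (mirror n x) (concat (map (qcol n) T))
content-identity [] x = refl
content-identity {n} {c ∷ T} (rc ∷ rT) x = begin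
  occ x (c ++ concat T) + occ x (pcol n c ++ concat Ps)
    ≡⟨ cong₂ _+_ (occ-++ x c (concat T)) (occ-++ x (pcol n c) (concat Ps)) ⟩
  (occ x c + occ x (concat T)) + (occ x (pcol n c) + occ x (concat Ps))
    ≡⟨ interchange (occ x c) _ _ _ ⟩
  (occ x c + occ x (pcol n c)) + (occ x (concat T) + occ x (concat Ps))
    ≡⟨ cong₂ _+_ (column-content rc x) (content-identity rT x) ⟩
  (N + occ y (qcol n c)) + (length T * N + occ y (concat Qs))
    ≡⟨ interchange N _ _ _ ⟩
  (N + length T * N) + (occ y (qcol n c) + occ y (concat Qs))
    ≡⟨ cong (N + length T * N +_) (occ-++ y (qcol n c) (concat Qs)) ⟨
  suc (length T) * N + occ y (qcol n c ++ concat Qs)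
    ∎
  where
  N y : ℕ
  N = occ x (oneTo n)
  y = mirror n x
  Ps Qs : Tableau
  Ps = map (pcol n) T
  Qs = map (qcol n) T

adjacent-columns⇒ : {n : ℕ} {c c' : Column} → RColumn n c → RColumn n c' → Prefix _≥_ c' c →
  Prefix _≥_ (pcol n c) (pcol n c') × Prefix _≥_ (qcol n c) (qcol n c')
adjacent-columns⇒ {n} {c} {c'} rc rc' rows =
  subst₂ (Prefix _≥_) (sym (pcol-small rc)) (sym (pcol-small rc'))
         (complement-antitone (small-subset rc) (small-subset rc') (proj₁ split))
  , Prefixₚ.map⁺ (mirror n) (mirror n) (Prefix.map (mirror-antitone {n}) (Suffixₚ.toPrefix-rev (proj₂ split)))
  where
  full-rows : Pointwise _≥_ (small n c' ++ large n c') (small n c ++ large n c)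
  full-rows = subst₂ (Pointwise _≥_) (sym (split-sorted n (proj₁ rc'))) (sym (split-sorted n (proj₁ rc)))
    (Prefixₚ.toPointwise (trans (proj₁ (proj₂ rc')) (sym (proj₁ (proj₂ rc)))) rows)
  split : Prefix _≥_ (small n c') (small n c) × Suffix _≤_ (large n c) (large n c')
  split = split-rows⇒ (small n c) (large n c) (small n c') (large n c')
    (Allₚ.all-filter (_≤? n) c') (Allₚ.all-filter (n <?_) c) full-rows

adjacent-columns⇐ : {n : ℕ} {p q p' q' : Column} → ColumnPair n p q → ColumnPair n p' q' →
  Prefix _≥_ p' p → Prefix _≥_ q' q → Prefix _≥_ (mkColumn n p q) (mkColumn n p' q')
adjacent-columns⇐ {n} {p} {q} {p'} {q'} pair pair' p-rows q-rows =
  Prefixₚ.fromPointwise (split-rows⇐ (complement n p') (map (mirror n) (reverse q'))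
                                     (complement n p) (map (mirror n) (reverse q))
    (complement-small pair') (All.map proj₁ (mirror-q-large pair)) equal-length
    (complement-antitone (proj₁ pair) (proj₁ pair') p-rows)
    (Suffixₚ.map⁺ (mirror n) (mirror n) (Suffix.map (mirror-antitone {n}) (Suffixₚ.fromPrefix q-rows))))
  where
  equal-length : length (mkColumn n p q) ≡ length (mkColumn n p' q')
  equal-length = trans (proj₁ (proj₂ (mkColumn-RColumn pair))) (sym (proj₁ (proj₂ (mkColumn-RColumn pair'))))

applyUpTo-cong : {f g : ℕ → Column} (m : ℕ) → (∀ i → i < m → f i ≡ g i) → applyUpTo f m ≡ applyUpTo g m
applyUpTo-cong zero _ = refl
applyUpTo-cong (suc m) same = cong₂ _∷_ (same 0 z<s) (applyUpTo-cong m (λ i i<m → same (suc i) (s≤s i<m)))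

applyUpTo-col : (h : Column → Column) (L : Tableau) → applyUpTo (λ i → h (col L i)) (length L) ≡ map h L
applyUpTo-col h [] = refl
applyUpTo-col h (c ∷ L) = cong (h c ∷_) (applyUpTo-col h L)

col-map : (f : Column → Column) → f [] ≡ [] → (L : Tableau) (j : ℕ) → col (map f L) j ≡ f (col L j)
col-map f f[] [] j = sym f[]
col-map f f[] (c ∷ L) zero = refl
col-map f f[] (c ∷ L) (suc j) = col-map f f[] L j

col-++ˡ : (a b : Tableau) {i : ℕ} → i < length a → col (a ++ b) i ≡ col a i
col-++ˡ (c ∷ a) b {zero} _ = refl
col-++ˡ (c ∷ a) b {suc i} (s≤s i<) = col-++ˡ a b i<

col-++-length : (a b : Tableau) → col (a ++ b) (length a) ≡ col b 0
col-++-length [] b = refl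
col-++-length (c ∷ a) b = col-++-length a b

col-reverse : (L : Tableau) {i : ℕ} → i < length L → col (reverse L) (length L ∸ suc i) ≡ col L i
col-reverse (c ∷ L) {zero} _ = begin
  col (reverse (c ∷ L)) (length L)        ≡⟨ cong (λ M → col M (length L)) (unfold-reverse c L) ⟩
  col (reverse L ++ [ c ]) (length L)     ≡⟨ cong (col (reverse L ++ [ c ])) (length-reverse L) ⟨
  col (reverse L ++ [ c ]) (length (reverse L)) ≡⟨ col-++-length (reverse L) [ c ] ⟩
  c                                       ∎
col-reverse (c ∷ L) {suc i} (s≤s i<) = begin
  col (reverse (c ∷ L)) (length L ∸ suc i)    ≡⟨ cong (λ M → col M (length L ∸ suc i)) (unfold-reverse c L) ⟩
  col (reverse L ++ [ c ]) (length L ∸ suc i) ≡⟨ col-++ˡ (reverse L) [ c ] inside ⟩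
  col (reverse L) (length L ∸ suc i)          ≡⟨ col-reverse L i< ⟩
  col L i                                     ∎
  where
  inside : length L ∸ suc i < length (reverse L)
  inside = subst (length L ∸ suc i <_) (sym (length-reverse L)) (∸-monoʳ-< z<s i<)

minus-columns : (n : ℕ) (R : Tableau) → minus (length R) n R (Qof n R) ≡ map (mcol n) R
minus-columns n R = begin
  map (λ i → take (n ∸ length (col (Qof n R) (length R ∸ 1 ∸ i))) (col R i)) (upTo (length R))
    ≡⟨ map-upTo _ (length R) ⟩
  applyUpTo (λ i → take (n ∸ length (col (Qof n R) (length R ∸ 1 ∸ i))) (col R i)) (length R)
    ≡⟨ applyUpTo-cong (length R) (λ i i< → cong (λ q → take (n ∸ length q) (col R i)) (Q-column i i<)) ⟩
  applyUpTo (λ i → mcol n (col R i)) (length R)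
    ≡⟨ applyUpTo-col (mcol n) R ⟩
  map (mcol n) R
    ∎
  where
  Q-column : ∀ i → i < length R → col (Qof n R) (length R ∸ 1 ∸ i) ≡ qcol n (col R i)
  Q-column i i< = begin
    col (map (qcol n) (reverse R)) (length R ∸ 1 ∸ i) ≡⟨ col-map (qcol n) refl (reverse R) _ ⟩
    qcol n (col (reverse R) (length R ∸ 1 ∸ i))       ≡⟨ cong (λ j → qcol n (col (reverse R) j)) (∸-+-assoc (length R) 1 i) ⟩
    qcol n (col (reverse R) (length R ∸ suc i))       ≡⟨ cong (qcol n) (col-reverse R i<) ⟩
    qcol n (col R i)                                  ∎

compl-columns : (n : ℕ) (A : Tableau) → compl (length A) n A ≡ map (complement n) (reverse A)
compl-columns n A = begin
  map (λ i → complement n (col A (length A ∸ 1 ∸ i))) (upTo (length A))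
    ≡⟨ map-upTo _ (length A) ⟩
  applyUpTo (λ i → complement n (col A (length A ∸ 1 ∸ i))) (length A)
    ≡⟨ applyUpTo-cong (length A) (λ i i< → cong (complement n) (reversed-column i i<)) ⟩
  applyUpTo (λ i → complement n (col (reverse A) i)) (length A)
    ≡⟨ cong (applyUpTo (λ i → complement n (col (reverse A) i))) (length-reverse A) ⟨
  applyUpTo (λ i → complement n (col (reverse A) i)) (length (reverse A))
    ≡⟨ applyUpTo-col (complement n) (reverse A) ⟩
  map (complement n) (reverse A)
    ∎
  where
  reversed-column : ∀ i → i < length A → col A (length A ∸ 1 ∸ i) ≡ col (reverse A) i
  reversed-column i i< = begin
    col A (length A ∸ 1 ∸ i)                              ≡⟨ cong₂ col (reverse-involutive A) index ⟨
    col (reverse (reverse A)) (length (reverse A) ∸ suc i) ≡⟨ col-reverse (reverse A) (subst (i <_) (sym (length-reverse A)) i<) ⟩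
    col (reverse A) i                                     ∎
    where
    index : length (reverse A) ∸ suc i ≡ length A ∸ 1 ∸ i
    index = trans (cong (_∸ suc i) (length-reverse A)) (sym (∸-+-assoc (length A) 1 i))

Φ-columns : {w n : ℕ} (R : Tableau) → length R ≡ w →
  Φ w n R ≡ (map (pcol n) (reverse R) , map (qcol n) (reverse R))
Φ-columns {n = n} R refl = cong (_, map (qcol n) (reverse R)) (begin
  compl (length R) n (minus (length R) n R (Qof n R))  ≡⟨ cong (compl (length R) n) (minus-columns n R) ⟩
  compl (length R) n (map (mcol n) R)                  ≡⟨ cong (λ w → compl w n (map (mcol n) R)) (length-map (mcol n) R) ⟨
  compl (length (map (mcol n) R)) n (map (mcol n) R)   ≡⟨ compl-columns n (map (mcol n) R) ⟩
  map (complement n) (reverse (map (mcol n) R))        ≡⟨ cong (map (complement n)) (reverse-map (mcol n) R) ⟨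
  map (complement n) (map (mcol n) (reverse R))        ≡⟨ map-∘ (reverse R) ⟨
  map (pcol n) (reverse R)                             ∎)

WeakRight StrictRight : Column → Column → Set
WeakRight c c' = Prefix _≥_ c' c
StrictRight c c' = Prefix _>_ c' c

AdjCols⇒Prefix : {R : ℕ → ℕ → Set} {c c' : Column} → AdjCols R c c' → Prefix (flip R) c' c
AdjCols⇒Prefix {c' = []} _ = []
AdjCols⇒Prefix {c = _ ∷ _} {_ ∷ _} (s≤s shorter , r ∷ rs) = r ∷ AdjCols⇒Prefix (shorter , rs)

Prefix⇒AdjCols : {R : ℕ → ℕ → Set} {c c' : Column} → Prefix (flip R) c' c → AdjCols R c c'
Prefix⇒AdjCols {R} rows = Prefixₚ.length-mono rows , row-by-row rows
  where
  row-by-row : {c c' : Column} → Prefix (flip R) c' c → All (uncurry R) (zip c c')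
  row-by-row {[]} [] = []
  row-by-row {_ ∷ _} [] = []
  row-by-row (r ∷ rs) = r ∷ row-by-row rs

strict-rows : {a b : Column} → Prefix _≥_ b a → (∀ {x} → x ∈ a → x ∈ b → ⊥) → Prefix _>_ b a
strict-rows [] _ = []
strict-rows (x≤y ∷ rows) disjoint =
  ≤∧≢⇒< x≤y (λ x≡y → disjoint (here refl) (here x≡y)) ∷ strict-rows rows (λ x∈ y∈ → disjoint (there x∈) (there y∈))

Linked-strict : {T : Tableau} → Linked WeakRight T → (∀ x → occ x (concat T) ≤ 1) → Linked StrictRight T
Linked-strict [] _ = []
Linked-strict [-] _ = [-]
Linked-strict {a ∷ b ∷ T} (r ∷ rs) once = strict-rows r disjoint ∷ Linked-strict rs once-rest
  where
  split-once : ∀ x → occ x a + occ x (concat (b ∷ T)) ≤ 1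
  split-once x = subst (_≤ 1) (occ-++ x a (concat (b ∷ T))) (once x)
  once-rest : ∀ x → occ x (concat (b ∷ T)) ≤ 1
  once-rest x = ≤-trans (m≤n+m _ (occ x a)) (split-once x)
  disjoint : ∀ {x} → x ∈ a → x ∈ b → ⊥
  disjoint {x} x∈a x∈b = <-irrefl refl (≤-trans (+-mono-≤ (occ-pos x x∈a) (occ-pos x (∈-++⁺ˡ x∈b))) (split-once x))

SYT-intro : {w n : ℕ} {T : Tableau} → length T ≡ w → concat T ↭ oneTo n →
  All (SubsetOf n) T → Linked WeakRight T → IsSYT w n T
SYT-intro {n = n} len perm subsets rows =
  len , perm , All.map (Linkedₚ.AllPairs⇒Linked ∘ proj₁) subsets ,
  Linked.map Prefix⇒AdjCols (Linked-strict rows (λ x → subst (_≤ 1) (sym (occ-↭ x perm)) (occ-oneTo≤1 n x)))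

SYT-elim : {w n : ℕ} {T : Tableau} → IsSYT w n T → All (SubsetOf n) T × Linked WeakRight T
SYT-elim {n = n} (_ , perm , columns , rows) =
  All.tabulate (λ c∈ → Linkedₚ.Linked⇒AllPairs <-trans (All.lookup columns c∈)
                       , All.tabulate (λ x∈ → All.lookup (oneTo-between n) (∈-resp-↭ perm (∈-concat⁺′ x∈ c∈))))
  , Linked.map (Prefix.map <⇒≤ ∘ AdjCols⇒Prefix) rows

entries-in : {n : ℕ} {T : Tableau} → All (SubsetOf n) T → All (Between 0 n) (concat T)
entries-in subsets = Allₚ.concat⁺ (All.map proj₂ subsets)

R-columns : {w n : ℕ} {R : Tableau} → IsR w n R → All (RColumn n) R
R-columns {w} ((increasing , _) , _ , lengths , content) = All.tabulate λ c∈ →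
  Linkedₚ.Linked⇒AllPairs <-trans (All.lookup increasing c∈) , All.lookup lengths c∈ ,
  All.tabulate (λ {x} x∈ → mult-support {w} (subst (0 <_) (content x) (occ-pos x (∈-concat⁺′ x∈ c∈))))

pair-up : {n : ℕ} {P Q : Tableau} → All (SubsetOf n) P → All (SubsetOf n) Q →
  map length P ≡ map length Q → Pointwise (ColumnPair n) P Q
pair-up [] [] _ = []
pair-up (sp ∷ sP) (sq ∷ sQ) same = (sp , sq , ∷-injectiveˡ same) ∷ pair-up sP sQ (∷-injectiveʳ same)
pair-up [] (_ ∷ _) ()
pair-up (_ ∷ _) [] ()

map-zipWith-left : {A B C : Set} {f : A → B → C} {g : C → A} {as : List A} {bs : List B} →
  Pointwise (λ a b → g (f a b) ≡ a) as bs → map g (zipWith f as bs) ≡ as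
map-zipWith-left [] = refl
map-zipWith-left (eq ∷ eqs) = cong₂ _∷_ eq (map-zipWith-left eqs)

map-zipWith-right : {A B C : Set} {f : A → B → C} {g : C → B} {as : List A} {bs : List B} →
  Pointwise (λ a b → g (f a b) ≡ b) as bs → map g (zipWith f as bs) ≡ bs
map-zipWith-right [] = refl
map-zipWith-right (eq ∷ eqs) = cong₂ _∷_ eq (map-zipWith-right eqs)

Linked-zipWith : {A B C : Set} {S₁ : A → A → Set} {S₂ : B → B → Set} {S : C → C → Set}
  {K : A → B → Set} {f : A → B → C} →
  (∀ {a b a' b'} → K a b → K a' b' → S₁ a a' → S₂ b b' → S (f a b) (f a' b')) →
  {as : List A} {bs : List B} → Pointwise K as bs → Linked S₁ as → Linked S₂ bs → Linked S (zipWith f as bs)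
Linked-zipWith h [] _ _ = []
Linked-zipWith h (_ ∷ []) _ _ = [-]
Linked-zipWith h (k ∷ k' ∷ ks) (r₁ ∷ rs₁) (r₂ ∷ rs₂) = h k k' r₁ r₂ ∷ Linked-zipWith h (k' ∷ ks) rs₁ rs₂

-- the inverse of Φ
Ψ : ℕ → Tableau × Tableau → Tableau
Ψ n (P , Q) = reverse (zipWith (mkColumn n) P Q)

rebuild : {n : ℕ} {T : Tableau} → All (RColumn n) T → zipWith (mkColumn n) (map (pcol n) T) (map (qcol n) T) ≡ T
rebuild [] = refl
rebuild (rc ∷ rT) = cong₂ _∷_ (mkColumn-pcol-qcol rc) (rebuild rT)

ΨΦ : {w n : ℕ} {R : Tableau} → IsR w n R → Ψ n (Φ w n R) ≡ R
ΨΦ {w} {n} {R} isR = begin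
  Ψ n (Φ w n R)                                                                          ≡⟨ cong (Ψ n) (Φ-columns R (proj₁ (proj₂ isR))) ⟩
  reverse (zipWith (mkColumn n) (map (pcol n) (reverse R)) (map (qcol n) (reverse R)))  ≡⟨ cong reverse (rebuild (All-reverse (R-columns isR))) ⟩
  reverse (reverse R)                                                                    ≡⟨ reverse-involutive R ⟩
  R                                                                                      ∎

module Forward {w n : ℕ} (1≤w : 1 ≤ w) {R : Tableau} (isR : IsR w n R) where

  T P Q : Tableau
  T = reverse R
  P = map (pcol n) T
  Q = map (qcol n) T

  columns : All (RColumn n) T
  columns = All-reverse (R-columns isR)

  rows : Linked (flip WeakRight) T
  rows = Linked-reverse (Linked.map AdjCols⇒Prefix (proj₂ (proj₁ isR)))

  length-T : length T ≡ w
  length-T = trans (length-reverse R) (proj₁ (proj₂ isR))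

  P-subsets : All (SubsetOf n) P
  P-subsets = Allₚ.gmap⁺ (λ {c} _ → complement-subset n (mcol n c)) columns

  Q-subsets : All (SubsetOf n) Q
  Q-subsets = Allₚ.gmap⁺ qcol-subset columns

  P-rows : Linked WeakRight P
  P-rows = Linkedₚ.map⁺ (Linked-map-on (λ rc rc' r → proj₁ (adjacent-columns⇒ rc' rc r)) columns rows)

  Q-rows : Linked WeakRight Q
  Q-rows = Linkedₚ.map⁺ (Linked-map-on (λ rc rc' r → proj₂ (adjacent-columns⇒ rc' rc r)) columns rows)

  shape : map length P ≡ map length Q
  shape = begin
    map length P              ≡⟨ map-∘ T ⟨
    map (length ∘ pcol n) T   ≡⟨ map-cong-local (All.map column-shape columns) ⟩
    map (length ∘ qcol n) T   ≡⟨ map-∘ T ⟩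
    map length Q              ∎

  balance : ∀ x → mult w n x + occ x (concat P) ≡ w * occ x (oneTo n) + occ (mirror n x) (concat Q)
  balance x = begin
    mult w n x + occ x (concat P)
      ≡⟨ cong (_+ occ x (concat P)) (trans (sym (proj₂ (proj₂ (proj₂ isR)) x)) (occ-↭ x (↭-sym (concat-reverse-↭ R)))) ⟩
    occ x (concat T) + occ x (concat P)
      ≡⟨ content-identity columns x ⟩
    length T * occ x (oneTo n) + occ (mirror n x) (concat Q)
      ≡⟨ cong (λ k → k * occ x (oneTo n) + occ (mirror n x) (concat Q)) length-T ⟩
    w * occ x (oneTo n) + occ (mirror n x) (concat Q)
      ∎

  -- x occurs in P as often as in [n]: for x outside [n] both counts vanish,
  -- for x in [n] the count of 2n+1-x in Q vanishes and balance decides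
  P-content : ∀ x → occ x (concat P) ≡ occ x (oneTo n)
  P-content x with between? 0 n x
  ... | no outside = occ-outside (entries-in P-subsets) outside
  ... | yes inside = +-cancelˡ-≡ (mult w n x) _ _ (begin
    mult w n x + occ x (concat P)                             ≡⟨ balance x ⟩
    w * occ x (oneTo n) + occ (mirror n x) (concat Q)         ≡⟨ cong (w * occ x (oneTo n) +_)
                                                                   (occ-outside (entries-in Q-subsets) (mirror-small-not-small inside)) ⟩
    w * occ x (oneTo n) + occ (mirror n x) (oneTo n)          ≡⟨ mult-identity 1≤w x ⟨
    mult w n x + occ x (oneTo n)                              ∎)

  Q-content-mirrored : ∀ x → occ (mirror n x) (concat Q) ≡ occ (mirror n x) (oneTo n)
  Q-content-mirrored x = +-cancelˡ-≡ (w * occ x (oneTo n)) _ _ (begin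
    w * occ x (oneTo n) + occ (mirror n x) (concat Q)         ≡⟨ balance x ⟨
    mult w n x + occ x (concat P)                             ≡⟨ cong (mult w n x +_) (P-content x) ⟩
    mult w n x + occ x (oneTo n)                              ≡⟨ mult-identity 1≤w x ⟩
    w * occ x (oneTo n) + occ (mirror n x) (oneTo n)          ∎)

  Q-content : ∀ y → occ y (concat Q) ≡ occ y (oneTo n)
  Q-content y with between? 0 n y
  ... | no outside = occ-outside (entries-in Q-subsets) outside
  ... | yes inside = subst (λ z → occ z (concat Q) ≡ occ z (oneTo n))
                           (mirror-involutive n (between-2n+1 n (small⇒between inside))) (Q-content-mirrored (mirror n y))

  SYT-pair : IsSYTPair w n (P , Q)
  SYT-pair =
    SYT-intro (trans (length-map (pcol n) T) length-T) (occ⇒↭ _ _ P-content) P-subsets P-rows ,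
    SYT-intro (trans (length-map (qcol n) T) length-T) (occ⇒↭ _ _ Q-content) Q-subsets Q-rows ,
    shape

module Backward {w n : ℕ} (1≤w : 1 ≤ w) {P Q : Tableau} (syt : IsSYTPair w n (P , Q)) where

  P-parts : All (SubsetOf n) P × Linked WeakRight P
  P-parts = SYT-elim (proj₁ syt)
  Q-parts : All (SubsetOf n) Q × Linked WeakRight Q
  Q-parts = SYT-elim (proj₁ (proj₂ syt))

  pairs : Pointwise (ColumnPair n) P Q
  pairs = pair-up (proj₁ P-parts) (proj₁ Q-parts) (proj₂ (proj₂ syt))

  T R : Tableau
  T = zipWith (mkColumn n) P Q
  R = reverse T

  columns : All (RColumn n) T
  columns = Allₚ.zipWith⁺ (mkColumn n) (Pw.map mkColumn-RColumn pairs)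

  P-columns : map (pcol n) T ≡ P
  P-columns = map-zipWith-left (Pw.map pcol-mkColumn pairs)

  Q-columns : map (qcol n) T ≡ Q
  Q-columns = map-zipWith-right (Pw.map qcol-mkColumn pairs)

  length-R : length R ≡ w
  length-R = begin
    length (reverse T)       ≡⟨ length-reverse T ⟩
    length T                 ≡⟨ length-map (pcol n) T ⟨
    length (map (pcol n) T)  ≡⟨ cong length P-columns ⟩
    length P                 ≡⟨ proj₁ (proj₁ syt) ⟩
    w                        ∎

  rows : Linked (flip WeakRight) T
  rows = Linked-zipWith adjacent-columns⇐ pairs (proj₂ P-parts) (proj₂ Q-parts)

  content : ∀ x → occ x (concat R) ≡ mult w n x
  content x = +-cancelʳ-≡ (occ x (oneTo n)) _ _ (begin
    occ x (concat R) + occ x (oneTo n)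
      ≡⟨ cong₂ _+_ (occ-↭ x (concat-reverse-↭ T)) (trans (occ-↭ x (↭-sym (proj₁ (proj₂ (proj₁ syt))))) (cong (occ x ∘ concat) (sym P-columns))) ⟩
    occ x (concat T) + occ x (concat (map (pcol n) T))
      ≡⟨ content-identity columns x ⟩
    length T * occ x (oneTo n) + occ (mirror n x) (concat (map (qcol n) T))
      ≡⟨ cong₂ (λ k Q' → k * occ x (oneTo n) + occ (mirror n x) (concat Q')) (trans (sym (length-reverse T)) length-R) Q-columns ⟩
    w * occ x (oneTo n) + occ (mirror n x) (concat Q)
      ≡⟨ cong (w * occ x (oneTo n) +_) (occ-↭ (mirror n x) (proj₁ (proj₂ (proj₁ (proj₂ syt))))) ⟩
    w * occ x (oneTo n) + occ (mirror n x) (oneTo n)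
      ≡⟨ mult-identity 1≤w x ⟨
    mult w n x + occ x (oneTo n)
      ∎)

  isR : IsR w n R
  isR = (All-reverse (All.map (Linkedₚ.AllPairs⇒Linked ∘ proj₁) columns) , Linked.map Prefix⇒AdjCols (Linked-reverse rows))
      , length-R , All-reverse (All.map (proj₁ ∘ proj₂) columns) , content

  ΦR : Φ w n R ≡ (P , Q)
  ΦR = begin
    Φ w n R                                               ≡⟨ Φ-columns R length-R ⟩
    (map (pcol n) (reverse R) , map (qcol n) (reverse R)) ≡⟨ cong (λ T' → map (pcol n) T' , map (qcol n) T') (reverse-involutive T) ⟩
    (map (pcol n) T , map (qcol n) T)                     ≡⟨ cong₂ _,_ P-columns Q-columns ⟩
    (P , Q)                                               ∎

lemma4p3 : (w n : ℕ) → 1 ≤ w → 1 ≤ n →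
    ((R : Tableau) → IsR w n R → IsSYTPair w n (Φ w n R))
    × ((R R' : Tableau) → IsR w n R → IsR w n R' → Φ w n R ≡ Φ w n R' → R ≡ R')
    × ((P Q : Tableau) → IsSYTPair w n (P , Q) → ∃[ R ] (IsR w n R × Φ w n R ≡ (P , Q)))
lemma4p3 w n 1≤w _ = lands-in-SYT-pairs , injective , surjective
  where
  lands-in-SYT-pairs : (R : Tableau) → IsR w n R → IsSYTPair w n (Φ w n R)
  lands-in-SYT-pairs R isR = subst (IsSYTPair w n) (sym (Φ-columns R (proj₁ (proj₂ isR)))) (Forward.SYT-pair 1≤w isR)

  injective : (R R' : Tableau) → IsR w n R → IsR w n R' → Φ w n R ≡ Φ w n R' → R ≡ R'
  injective R R' isR isR' same = begin
    R               ≡⟨ ΨΦ isR ⟨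
    Ψ n (Φ w n R)   ≡⟨ cong (Ψ n) same ⟩
    Ψ n (Φ w n R')  ≡⟨ ΨΦ isR' ⟩
    R'              ∎

  surjective : (P Q : Tableau) → IsSYTPair w n (P , Q) → ∃[ R ] (IsR w n R × Φ w n R ≡ (P , Q))
  surjective P Q syt = Backward.R 1≤w syt , Backward.isR 1≤w syt , Backward.ΦR 1≤w syt
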